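{- For each $n\geq 1$, the chromatic polynomial of $\Gamma_n^{\ast}$ is $$\chi_n(\lambda) = -\lambda(1-\lambda)^{2^n-1}.$$
   Context: Let $X^n$ denote the set of binary words of length $n$ over $\{0,1\}$. The Grigorchuk group is generated by the automorphisms $a,b,c,d$ of the rooted binary tree defined recursively on finite binary words $w$ by $a(0w)=1w$, $a(1w)=0w$, $b(0w)=0a(w)$, $b(1w)=1c(w)$, $c(0w)=0a(w)$, $c(1w)=1d(w)$, $d(0w)=0w$, $d(1w)=1b(w)$; each generator is an involution. For $n\geq1$, the Schreier graph $\Gamma_n$ is the finite multigraph with vertex set $X^n$ having, for each $s\in\{a,b,c,d\}$ and each orbit $\{u,s(u)\}$ of $s$ on $X^n$, one edge joining $u$ and $s(u)$ (a loop when $s(u)=u$). $\Gamma_n^\ast$ is the multigraph obtained from $\Gamma_n$ by deleting all loops. The chromatic polynomial $\chi_n(\lambda)$ is the polynomial giving, for each positive integer $\lambda$, the number of assignments of one of $\lambda$ colors to each vertex of $\Gamma_n^\ast$ such that adjacent vertices receive distinct colors. -}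

module Defs where

open import Data.Bool using (Bool; true; false)
import Data.Bool as B
open import Data.Nat using (ℕ; zero; suc)
open import Data.Fin using (Fin)
import Data.Fin as F
open import Data.Vec using (Vec; []; _∷_)
open import Data.Vec.Properties using (≡-dec)
open import Data.List using (List; []; _∷_; map; concatMap; filter; length; allFin)
open import Data.List.Relation.Unary.All using (All)
open import Data.List.Relation.Unary.All.Properties using ()
import Data.List.Relation.Unary.All as All
open import Relation.Binary.PropositionalEquality using (_≡_; _≢_)
open import Relation.Nullary using (Dec; ¬_)
open import Relation.Nullary.Decidable using (_→-dec_; ¬?)

-- Binary words of length n (X^n), first letter = head of the vector.
Word : ℕ → Set
Word n = Vec Bool n

-- Generators of the Grigorchuk group, acting on finite binary words.
data Gen : Set where
  ga gb gc gd : Gen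

gens : List Gen
gens = ga ∷ gb ∷ gc ∷ gd ∷ []

actA actB actC actD : {n : ℕ} → Word n → Word n
actA []            = []
actA (false ∷ w)   = true ∷ w
actA (true ∷ w)    = false ∷ w
actB []            = []
actB (false ∷ w)   = false ∷ actA w
actB (true ∷ w)    = true ∷ actC w
actC []            = []
actC (false ∷ w)   = false ∷ actA w
actC (true ∷ w)    = true ∷ actD w
actD []            = []
actD (false ∷ w)   = false ∷ w
actD (true ∷ w)    = true ∷ actB w

act : {n : ℕ} → Gen → Word n → Word n
act ga = actA
act gb = actB
act gc = actC
act gd = actD

allWords : (n : ℕ) → List (Word n)
allWords zero    = [] ∷ []
allWords (suc n) = map (false ∷_) (allWords n) Data.List.++ map (true ∷_) (allWords n)

-- Adjacency in Γ_n^* (Schreier graph with loops deleted): u ~ v iff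
-- v = s(u) for some generator s and v ≠ u.  (Edge multiplicities are
-- irrelevant for colourings.)
-- A colouring col is proper iff for every word u and generator s with
-- s(u) ≠ u, col u ≠ col (s u).
ProperAt : {n k : ℕ} → (Word n → Fin k) → Word n → Gen → Set
ProperAt col u s = ¬ (act s u ≡ u) → col u ≢ col (act s u)

Proper : {n k : ℕ} → (Word n → Fin k) → Set
Proper {n} col = All (λ u → All (ProperAt col u) gens) (allWords n)

properAt? : {n k : ℕ} (col : Word n → Fin k) (u : Word n) (s : Gen) → Dec (ProperAt col u s)
properAt? col u s = ¬? (≡-dec B._≟_ (act s u) u) →-dec ¬? (col u F.≟ col (act s u))

proper? : {n k : ℕ} (col : Word n → Fin k) → Dec (Proper col)
proper? {n} col = All.all? (λ u → All.all? (properAt? col u) gens) (allWords n)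

-- Enumeration of all maps X^n → Fin k (each map occurs exactly once,
-- up to pointwise equality).
allColourings : (n k : ℕ) → List (Word n → Fin k)
allColourings zero    k = map (λ c _ → c) (allFin k)
allColourings (suc n) k =
  concatMap (λ f → map (λ g → join f g) (allColourings n k)) (allColourings n k)
  where
  join : (Word n → Fin k) → (Word n → Fin k) → Word (suc n) → Fin k
  join f g (false ∷ w) = f w
  join f g (true ∷ w)  = g w

chromaticCount : (n k : ℕ) → ℕ
chromaticCount n k = length (filter proper? (allColourings n k))

-- After deleting loops and merging parallel edges, Γ_n^* is a tree on the 2^n words.  Its
-- edges can be listed so that the target of each edge meets no later edge, i.e. is a leaf of
-- the forest formed by that edge and the later ones.  A condition on colourings that does not
-- involve a vertex v is met equally often for every colour of v, so adding a leaf edge keeps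
-- exactly the fraction (λ - 1)/λ of the colourings.  Hence
-- χ_n(λ) = λ^(2^n) ((λ - 1)/λ)^(2^n - 1) = λ (λ - 1)^(2^n - 1), and 2^n - 1 is odd.
-- The tree is built from two copies of the tree for Γ_(n-1), following the self-similar
-- action of the generators.

module Submission where

open import Defs
open import Data.Nat using (ℕ; _≤_; _∸_)
open import Data.Integer using (ℤ; +_; -_; _*_; _-_; _^_)
open import Relation.Binary.PropositionalEquality using (_≡_)

open import Data.Bool using (Bool; true; false; _∧_; not; if_then_else_)
open import Data.Bool.Properties using (∧-zeroʳ; not-¬)
open import Data.Empty using (⊥-elim)
open import Data.Fin using (Fin; _≟_) renaming (zero to fzero; suc to fsuc)
import Data.Integer.Properties as ℤ
import Data.Integer.Tactic.RingSolver as ℤ-Solver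
open import Data.List using (List; []; _∷_; _++_; map; concatMap; filter; length; allFin; tabulate)
open import Data.List.Membership.Propositional using (_∈_)
open import Data.List.Membership.Propositional.Properties using (∈-++⁺ˡ; ∈-++⁺ʳ; ∈-map⁺)
import Data.List.Properties as Listₚ
open import Data.List.Relation.Unary.All using (All; []; _∷_; all?)
import Data.List.Relation.Unary.All as All
import Data.List.Relation.Unary.All.Properties as All
open import Data.List.Relation.Unary.Any using (Any; here; there)
import Data.List.Relation.Unary.Any.Properties as Any
open import Data.Nat using (zero; suc; _+_)
import Data.Nat as ℕ
import Data.Nat.Properties as ℕ
open import Data.Nat.Tactic.RingSolver using (solve-∀)
open import Algebra.Properties.CommutativeSemigroup ℕ.+-commutativeSemigroup
  using () renaming (interchange to +-interchange)
import Algebra.Properties.CommutativeSemigroup ℕ.*-commutativeSemigroup as *-CS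
open import Data.Product using (_×_; _,_)
open import Data.Product.Function.NonDependent.Propositional using (_×-⇔_)
open import Data.Sum using (_⊎_; inj₁; inj₂)
open import Data.Vec using ([]; _∷_; replicate)
open import Data.Vec.Properties using (∷-injectiveˡ; ∷-injectiveʳ)
open import Function using (_∘_)
open import Function.Bundles using (_⇔_; mk⇔)
open import Function.Construct.Composition using (_⇔-∘_)
open import Function.Construct.Symmetry using (⇔-sym)
open import Function.Definitions using (Congruent)
open import Relation.Binary.PropositionalEquality
  using (refl; sym; trans; cong; cong₂; subst; _≢_; _≗_; module ≡-Reasoning)
open import Relation.Nullary using (Dec; does; yes; no; ¬_; ¬?)
open import Relation.Nullary.Decidable using (does-⇔)

open ≡-Reasoning

private
  variable
    A B : Set
    n k : ℕ

-- Finite sums and counts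

∑ : (A → ℕ) → List A → ℕ
∑ f []       = 0
∑ f (x ∷ xs) = f x + ∑ f xs

∑-cong : {f g : A → ℕ} → f ≗ g → (xs : List A) → ∑ f xs ≡ ∑ g xs
∑-cong f≗g []       = refl
∑-cong f≗g (x ∷ xs) = cong₂ _+_ (f≗g x) (∑-cong f≗g xs)

∑-zero : (xs : List A) → ∑ (λ _ → 0) xs ≡ 0
∑-zero []       = refl
∑-zero (x ∷ xs) = ∑-zero xs

∑-const : (m : ℕ) (xs : List A) → ∑ (λ _ → m) xs ≡ length xs ℕ.* m
∑-const m []       = refl
∑-const m (x ∷ xs) = cong (m ℕ.+_) (∑-const m xs)

∑-+ : (f g : A → ℕ) (xs : List A) → ∑ (λ x → f x + g x) xs ≡ ∑ f xs + ∑ g xs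
∑-+ f g []       = refl
∑-+ f g (x ∷ xs) = begin
  (f x + g x) + ∑ (λ x → f x + g x) xs ≡⟨ cong ((f x + g x) ℕ.+_) (∑-+ f g xs) ⟩
  (f x + g x) + (∑ f xs + ∑ g xs)      ≡⟨ +-interchange (f x) (g x) _ _ ⟩
  (f x + ∑ f xs) + (g x + ∑ g xs)      ∎

∑-*ˡ : (m : ℕ) (f : A → ℕ) (xs : List A) → ∑ (λ x → m ℕ.* f x) xs ≡ m ℕ.* ∑ f xs
∑-*ˡ m f []       = sym (ℕ.*-zeroʳ m)
∑-*ˡ m f (x ∷ xs) =
  trans (cong (m ℕ.* f x ℕ.+_) (∑-*ˡ m f xs)) (sym (ℕ.*-distribˡ-+ m (f x) (∑ f xs)))

∑-comm : (f : A → B → ℕ) (xs : List A) (ys : List B) →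
         ∑ (λ x → ∑ (f x) ys) xs ≡ ∑ (λ y → ∑ (λ x → f x y) xs) ys
∑-comm f []       ys = sym (∑-zero ys)
∑-comm f (x ∷ xs) ys = trans (cong (∑ (f x) ys ℕ.+_) (∑-comm f xs ys)) (sym (∑-+ (f x) _ ys))

∑-map : (f : B → ℕ) (h : A → B) (xs : List A) → ∑ f (map h xs) ≡ ∑ (f ∘ h) xs
∑-map f h []       = refl
∑-map f h (x ∷ xs) = cong (f (h x) ℕ.+_) (∑-map f h xs)

∑-++ : (f : A → ℕ) (xs ys : List A) → ∑ f (xs ++ ys) ≡ ∑ f xs + ∑ f ys
∑-++ f []       ys = refl
∑-++ f (x ∷ xs) ys = trans (cong (f x ℕ.+_) (∑-++ f xs ys)) (sym (ℕ.+-assoc (f x) _ _))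

∑-concatMap : (f : B → ℕ) (h : A → List B) (xs : List A) →
              ∑ f (concatMap h xs) ≡ ∑ (∑ f ∘ h) xs
∑-concatMap f h []       = refl
∑-concatMap f h (x ∷ xs) =
  trans (∑-++ f (h x) (concatMap h xs)) (cong (∑ f (h x) ℕ.+_) (∑-concatMap f h xs))

∑-tabulate : (f : A → ℕ) (g : Fin k → A) → ∑ f (tabulate g) ≡ ∑ (f ∘ g) (allFin k)
∑-tabulate {k = zero}  f g = refl
∑-tabulate {k = suc k} f g = cong (f (g fzero) ℕ.+_) (begin
  ∑ f (tabulate (g ∘ fsuc))   ≡⟨ ∑-tabulate f (g ∘ fsuc) ⟩
  ∑ (f ∘ g ∘ fsuc) (allFin k) ≡⟨ ∑-tabulate (f ∘ g) fsuc ⟨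
  ∑ (f ∘ g) (tabulate fsuc)   ∎)

∑-allFin-suc : (f : Fin (suc k) → ℕ) → ∑ f (allFin (suc k)) ≡ f fzero + ∑ (f ∘ fsuc) (allFin k)
∑-allFin-suc f = cong (f fzero ℕ.+_) (∑-tabulate f fsuc)

∑-const-allFin : (k m : ℕ) → ∑ (λ _ → m) (allFin k) ≡ k ℕ.* m
∑-const-allFin zero    m = refl
∑-const-allFin (suc k) m =
  trans (∑-allFin-suc {k = k} (λ _ → m)) (cong (m ℕ.+_) (∑-const-allFin k m))

indicator : Bool → ℕ
indicator b = if b then 1 else 0

indicator-∧ : (a b : Bool) → indicator (a ∧ b) ≡ indicator a ℕ.* indicator b
indicator-∧ true  b = sym (ℕ.+-identityʳ (indicator b))
indicator-∧ false b = refl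

count : (A → Bool) → List A → ℕ
count p = ∑ (indicator ∘ p)

count-true : (xs : List A) → count (λ _ → true) xs ≡ length xs
count-true []       = refl
count-true (x ∷ xs) = cong suc (count-true xs)

length-filter≡count : {P : A → Set} (P? : ∀ x → Dec (P x)) (xs : List A) →
                      length (filter P? xs) ≡ count (does ∘ P?) xs
length-filter≡count P? []       = refl
length-filter≡count P? (x ∷ xs) with does (P? x)
... | true  = cong suc (length-filter≡count P? xs)
... | false = length-filter≡count P? xs

count-x≟-allFin : (x : Fin k) → count (λ y → does (x ≟ y)) (allFin k) ≡ 1
count-x≟-allFin {suc k} fzero    =
  trans (∑-allFin-suc {k = k} (indicator ∘ does ∘ (fzero ≟_))) (cong suc (∑-zero (allFin k)))
count-x≟-allFin {suc k} (fsuc x) =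
  trans (∑-allFin-suc {k = k} (indicator ∘ does ∘ (fsuc x ≟_))) (count-x≟-allFin x)

count-≟x-allFin : (x : Fin k) → count (λ y → does (y ≟ x)) (allFin k) ≡ 1
count-≟x-allFin {suc k} fzero    =
  trans (∑-allFin-suc {k = k} (indicator ∘ does ∘ (_≟ fzero))) (cong suc (∑-zero (allFin k)))
count-≟x-allFin {suc k} (fsuc x) =
  trans (∑-allFin-suc {k = k} (indicator ∘ does ∘ (_≟ fsuc x))) (count-≟x-allFin x)

count-∧ˡ : (b : Bool) (q : A → Bool) (xs : List A) →
           count (λ x → b ∧ q x) xs ≡ indicator b ℕ.* count q xs
count-∧ˡ b q xs = trans (∑-cong (λ x → indicator-∧ b (q x)) xs) (∑-*ˡ (indicator b) (indicator ∘ q) xs)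

count-split : (q p : A → Bool) (xs : List A) →
              count p xs ≡ count (λ x → not (q x) ∧ p x) xs + count (λ x → p x ∧ q x) xs
count-split q p xs = trans (∑-cong split xs) (∑-+ _ _ xs)
  where
  split : ∀ x → indicator (p x) ≡ indicator (not (q x) ∧ p x) + indicator (p x ∧ q x)
  split x with p x | q x
  ... | true  | true  = refl
  ... | true  | false = refl
  ... | false | true  = refl
  ... | false | false = refl

count-partition : (f : A → Fin k) (p : A → Bool) (xs : List A) →
                  count p xs ≡ ∑ (λ y → count (λ x → p x ∧ does (f x ≟ y)) xs) (allFin k)
count-partition {k = k} f p xs = trans (∑-cong split xs) (∑-comm _ xs (allFin k))
  where
  split : ∀ x → indicator (p x) ≡ count (λ y → p x ∧ does (f x ≟ y)) (allFin k)
  split x = begin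
    indicator (p x)                                        ≡⟨ ℕ.*-identityʳ _ ⟨
    indicator (p x) ℕ.* 1                                  ≡⟨ cong (indicator (p x) ℕ.*_) (count-x≟-allFin (f x)) ⟨
    indicator (p x) ℕ.* count (does ∘ (f x ≟_)) (allFin k) ≡⟨ count-∧ˡ (p x) _ (allFin k) ⟨
    count (λ y → p x ∧ does (f x ≟ y)) (allFin k)          ∎

-- Counting colourings

Colouring : ℕ → ℕ → Set
Colouring n k = Word n → Fin k

_⊕_ : Colouring n k → Colouring n k → Colouring (suc n) k
(f ⊕ g) (false ∷ w) = f w
(f ⊕ g) (true  ∷ w) = g w

-- allColourings glues its two halves with a local function that agrees with _⊕_ only pointwise.
count-allColourings-suc : (q : Colouring (suc n) k → Bool) → Congruent _≗_ _≡_ q →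
  count q (allColourings (suc n) k) ≡
  ∑ (λ f → count (λ g → q (f ⊕ g)) (allColourings n k)) (allColourings n k)
count-allColourings-suc {n} {k} q q-cong =
  trans (∑-concatMap _ _ L) (∑-cong (λ f → trans (∑-map _ _ L) (∑-cong (λ g → cong indicator (q-cong
    λ { (false ∷ w) → refl ; (true ∷ w) → refl })) L)) L)
  where
  L : List (Colouring n k)
  L = allColourings n k

length-allColourings : (n k : ℕ) → length (allColourings n k) ≡ k ℕ.^ 2 ℕ.^ n
length-allColourings zero    k =
  trans (Listₚ.length-map _ (allFin k)) (trans (Listₚ.length-tabulate _) (sym (ℕ.*-identityʳ k)))
length-allColourings (suc n) k = begin
  length (allColourings (suc n) k)
    ≡⟨ count-true (allColourings (suc n) k) ⟨
  count (λ _ → true) (allColourings (suc n) k)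
    ≡⟨ count-allColourings-suc {n} {k} (λ _ → true) (λ _ → refl) ⟩
  ∑ (λ _ → count (λ _ → true) L) L
    ≡⟨ ∑-const _ L ⟩
  length L ℕ.* count (λ _ → true) L
    ≡⟨ cong (length L ℕ.*_) (count-true L) ⟩
  length L ℕ.* length L
    ≡⟨ cong₂ ℕ._*_ (length-allColourings n k) (length-allColourings n k) ⟩
  k ℕ.^ 2 ℕ.^ n ℕ.* k ℕ.^ 2 ℕ.^ n
    ≡⟨ ℕ.^-distribˡ-+-* k (2 ℕ.^ n) (2 ℕ.^ n) ⟨
  k ℕ.^ (2 ℕ.^ n + 2 ℕ.^ n)
    ≡⟨ cong (λ m → k ℕ.^ (2 ℕ.^ n + m)) (ℕ.+-identityʳ (2 ℕ.^ n)) ⟨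
  k ℕ.^ 2 ℕ.^ suc n ∎
  where
  L : List (Colouring n k)
  L = allColourings n k

AgreeOff : Word n → Colouring n k → Colouring n k → Set
AgreeOff v c c′ = ∀ w → w ≢ v → c w ≡ c′ w

IgnoresAt : Word n → (Colouring n k → Bool) → Set
IgnoresAt v p = Congruent (AgreeOff v) _≡_ p

hasColour : Word n → Fin k → Colouring n k → Bool
hasColour v x c = does (c v ≟ x)

module _ {v : Word n} {p : Colouring n k → Bool} (p-ign : IgnoresAt v p) where

  ignoresAt⇒congruent : Congruent _≗_ _≡_ p
  ignoresAt⇒congruent c≗c′ = p-ign (λ w _ → c≗c′ w)

  ∧-hasColour-congruent : (x : Fin k) → Congruent _≗_ _≡_ (λ c → p c ∧ hasColour v x c)
  ∧-hasColour-congruent x c≗c′ =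
    cong₂ _∧_ (ignoresAt⇒congruent c≗c′) (cong (λ z → does (z ≟ x)) (c≗c′ v))

  ∧-hasColour-ignoresAt : {u : Word n} → u ≢ v → (x : Fin k) → IgnoresAt v (λ c → p c ∧ hasColour u x c)
  ∧-hasColour-ignoresAt {u} u≢v x agree =
    cong₂ _∧_ (p-ign agree) (cong (λ z → does (z ≟ x)) (agree u u≢v))

ignoresAt-⊕ˡ : {v : Word n} {p : Colouring (suc n) k → Bool} → IgnoresAt (false ∷ v) p →
               (g : Colouring n k) → IgnoresAt v (λ f → p (f ⊕ g))
ignoresAt-⊕ˡ p-ign g agree = p-ign λ
  { (false ∷ w) w≢v → agree w (w≢v ∘ cong (false ∷_))
  ; (true  ∷ w) _   → refl }

ignoresAt-⊕ʳ : {v : Word n} {p : Colouring (suc n) k → Bool} → IgnoresAt (true ∷ v) p →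
               (f : Colouring n k) → IgnoresAt v (λ g → p (f ⊕ g))
ignoresAt-⊕ʳ p-ign f agree = p-ign λ
  { (false ∷ w) _   → refl
  ; (true  ∷ w) w≢v → agree w (w≢v ∘ cong (true ∷_)) }

count-hasColour-uniform : (v : Word n) {p : Colouring n k → Bool} → IgnoresAt v p → (x y : Fin k) →
  count (λ c → p c ∧ hasColour v x c) (allColourings n k) ≡
  count (λ c → p c ∧ hasColour v y c) (allColourings n k)
count-hasColour-uniform {zero} {k} [] {p} p-ign x y = trans (constant x) (sym (constant y))
  where
  p₀ : Bool
  p₀ = p (λ _ → x)
  p-constant : ∀ z → p (λ _ → z) ≡ p₀
  p-constant z = p-ign λ { [] []≢[] → ⊥-elim ([]≢[] refl) }
  constant : ∀ t → count (λ c → p c ∧ hasColour [] t c) (allColourings zero k) ≡ indicator p₀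
  constant t = begin
    count (λ c → p c ∧ hasColour [] t c) (map (λ z _ → z) (allFin k))
      ≡⟨ ∑-map _ (λ z _ → z) (allFin k) ⟩
    count (λ z → p (λ _ → z) ∧ does (z ≟ t)) (allFin k)
      ≡⟨ ∑-cong (λ z → cong (λ b → indicator (b ∧ does (z ≟ t))) (p-constant z)) (allFin k) ⟩
    count (λ z → p₀ ∧ does (z ≟ t)) (allFin k)
      ≡⟨ count-∧ˡ p₀ _ (allFin k) ⟩
    indicator p₀ ℕ.* count (λ z → does (z ≟ t)) (allFin k)
      ≡⟨ cong (indicator p₀ ℕ.*_) (count-≟x-allFin t) ⟩
    indicator p₀ ℕ.* 1
      ≡⟨ ℕ.*-identityʳ _ ⟩
    indicator p₀ ∎
count-hasColour-uniform {suc n} {k} (false ∷ v) {p} p-ign x y = begin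
  count (λ c → p c ∧ hasColour (false ∷ v) x c) (allColourings (suc n) k)
    ≡⟨ halves x ⟩
  ∑ (λ g → count (λ f → p (f ⊕ g) ∧ hasColour v x f) L) L
    ≡⟨ ∑-cong (λ g → count-hasColour-uniform v (ignoresAt-⊕ˡ p-ign g) x y) L ⟩
  ∑ (λ g → count (λ f → p (f ⊕ g) ∧ hasColour v y f) L) L
    ≡⟨ halves y ⟨
  count (λ c → p c ∧ hasColour (false ∷ v) y c) (allColourings (suc n) k) ∎
  where
  L : List (Colouring n k)
  L = allColourings n k
  halves : ∀ t → count (λ c → p c ∧ hasColour (false ∷ v) t c) (allColourings (suc n) k) ≡
                 ∑ (λ g → count (λ f → p (f ⊕ g) ∧ hasColour v t f) L) L
  halves t = trans (count-allColourings-suc _ (∧-hasColour-congruent p-ign t)) (∑-comm _ L L)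
count-hasColour-uniform {suc n} {k} (true ∷ v) {p} p-ign x y = begin
  count (λ c → p c ∧ hasColour (true ∷ v) x c) (allColourings (suc n) k)
    ≡⟨ count-allColourings-suc _ (∧-hasColour-congruent p-ign x) ⟩
  ∑ (λ f → count (λ g → p (f ⊕ g) ∧ hasColour v x g) L) L
    ≡⟨ ∑-cong (λ f → count-hasColour-uniform v (ignoresAt-⊕ʳ p-ign f) x y) L ⟩
  ∑ (λ f → count (λ g → p (f ⊕ g) ∧ hasColour v y g) L) L
    ≡⟨ count-allColourings-suc _ (∧-hasColour-congruent p-ign y) ⟨
  count (λ c → p c ∧ hasColour (true ∷ v) y c) (allColourings (suc n) k) ∎
  where
  L : List (Colouring n k)
  L = allColourings n k

*-count-hasColour : {v : Word n} {p : Colouring n k → Bool} → IgnoresAt v p → (x : Fin k) →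
  k ℕ.* count (λ c → p c ∧ hasColour v x c) (allColourings n k) ≡ count p (allColourings n k)
*-count-hasColour {n} {k} {v} {p} p-ign x = begin
  k ℕ.* count (λ c → p c ∧ hasColour v x c) L
    ≡⟨ ∑-const-allFin k _ ⟨
  ∑ (λ y → count (λ c → p c ∧ hasColour v x c) L) (allFin k)
    ≡⟨ ∑-cong (λ y → count-hasColour-uniform v p-ign x y) (allFin k) ⟩
  ∑ (λ y → count (λ c → p c ∧ hasColour v y c) L) (allFin k)
    ≡⟨ count-partition (λ c → c v) p L ⟨
  count p L ∎
  where
  L : List (Colouring n k)
  L = allColourings n k

∧-≟-transfer : (b : Bool) (x y z : Fin k) →
               (b ∧ does (x ≟ y)) ∧ does (y ≟ z) ≡ (b ∧ does (x ≟ z)) ∧ does (y ≟ z)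
∧-≟-transfer b x y z with y ≟ z
... | yes refl = refl
... | no  _    = trans (∧-zeroʳ _) (sym (∧-zeroʳ _))

-- Once the colour x of v is fixed, asking c u = c v is asking c u = x, which no longer involves v.
*-count-equalColours : {u v : Word n} {p : Colouring n k → Bool} → u ≢ v → IgnoresAt v p →
  k ℕ.* count (λ c → p c ∧ does (c u ≟ c v)) (allColourings n k) ≡ count p (allColourings n k)
*-count-equalColours {n} {k} {u} {v} {p} u≢v p-ign = begin
  k ℕ.* count (λ c → p c ∧ does (c u ≟ c v)) L
    ≡⟨ cong (k ℕ.*_) (count-partition (λ c → c v) _ L) ⟩
  k ℕ.* ∑ (λ x → count (λ c → (p c ∧ does (c u ≟ c v)) ∧ hasColour v x c) L) (allFin k)
    ≡⟨ cong (k ℕ.*_) (∑-cong (λ x → ∑-cong (λ c → cong indicator (∧-≟-transfer (p c) (c u) (c v) x)) L)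
                             (allFin k)) ⟩
  k ℕ.* ∑ (λ x → count (λ c → (p c ∧ hasColour u x c) ∧ hasColour v x c) L) (allFin k)
    ≡⟨ ∑-*ˡ k _ (allFin k) ⟨
  ∑ (λ x → k ℕ.* count (λ c → (p c ∧ hasColour u x c) ∧ hasColour v x c) L) (allFin k)
    ≡⟨ ∑-cong (λ x → *-count-hasColour (∧-hasColour-ignoresAt p-ign u≢v x) x) (allFin k) ⟩
  ∑ (λ x → count (λ c → p c ∧ hasColour u x c) L) (allFin k)
    ≡⟨ count-partition (λ c → c u) p L ⟨
  count p L ∎
  where
  L : List (Colouring n k)
  L = allColourings n k

-- Colourings proper on an edge list

data Kind : Set where
  a-kind bcd-kind : Kind

record Edge (n : ℕ) : Set where
  constructor edge
  field
    kind    : Kind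
    src tgt : Word n

open Edge

ProperOn : List (Edge n) → Colouring n k → Set
ProperOn E c = All (λ e → c (src e) ≢ c (tgt e)) E

properOn? : (E : List (Edge n)) (c : Colouring n k) → Dec (ProperOn E c)
properOn? E c = all? (λ e → ¬? (c (src e) ≟ c (tgt e))) E

properOnᵇ : List (Edge n) → Colouring n k → Bool
properOnᵇ E c = does (properOn? E c)

Avoids : Word n → Edge n → Set
Avoids v e = src e ≢ v × tgt e ≢ v

data LeafOrdered {n : ℕ} : List (Edge n) → Set where
  []  : LeafOrdered []
  _∷_ : {e : Edge n} {E : List (Edge n)} →
        src e ≢ tgt e × All (Avoids (tgt e)) E → LeafOrdered E → LeafOrdered (e ∷ E)

properOnᵇ-ignoresAt : {v : Word n} {E : List (Edge n)} → All (Avoids v) E → IgnoresAt {k = k} v (properOnᵇ E)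
properOnᵇ-ignoresAt []                              agree = refl
properOnᵇ-ignoresAt {E = e ∷ _} ((s≢v , t≢v) ∷ avs) agree =
  cong₂ _∧_ (cong₂ (λ x y → not (does (x ≟ y))) (agree (src e) s≢v) (agree (tgt e) t≢v))
            (properOnᵇ-ignoresAt avs agree)

count-properOnᵇ-leaf : {j : ℕ} {e : Edge n} {E : List (Edge n)} → src e ≢ tgt e → All (Avoids (tgt e)) E →
  suc j ℕ.* count (properOnᵇ (e ∷ E)) (allColourings n (suc j)) ≡
  j ℕ.* count (properOnᵇ E) (allColourings n (suc j))
count-properOnᵇ-leaf {n} {j} {e} {E} s≢t avs = ℕ.+-cancelʳ-≡ χ (suc j ℕ.* χₑ) (j ℕ.* χ) (begin
  suc j ℕ.* χₑ + χ            ≡⟨ cong (suc j ℕ.* χₑ ℕ.+_) equal-scaled ⟨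
  suc j ℕ.* χₑ + suc j ℕ.* χ₌ ≡⟨ ℕ.*-distribˡ-+ (suc j) χₑ χ₌ ⟨
  suc j ℕ.* (χₑ + χ₌)         ≡⟨ cong (suc j ℕ.*_) split ⟨
  suc j ℕ.* χ                 ≡⟨ ℕ.+-comm χ (j ℕ.* χ) ⟩
  j ℕ.* χ + χ                 ∎)
  where
  L : List (Colouring n (suc j))
  L = allColourings n (suc j)
  equal : Colouring n (suc j) → Bool
  equal c = does (c (src e) ≟ c (tgt e))
  χ χₑ χ₌ : ℕ
  χ  = count (properOnᵇ E) L
  χₑ = count (properOnᵇ (e ∷ E)) L
  χ₌ = count (λ c → properOnᵇ E c ∧ equal c) L
  split : χ ≡ χₑ + χ₌
  split = count-split equal (properOnᵇ E) L
  equal-scaled : suc j ℕ.* χ₌ ≡ χ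
  equal-scaled = *-count-equalColours s≢t (properOnᵇ-ignoresAt avs)

count-properOnᵇ-leafOrdered : {j : ℕ} {E : List (Edge n)} → LeafOrdered E →
  suc j ℕ.^ length E ℕ.* count (properOnᵇ E) (allColourings n (suc j)) ≡
  j ℕ.^ length E ℕ.* length (allColourings n (suc j))
count-properOnᵇ-leafOrdered {n} {j} [] = cong (ℕ._+ 0) (count-true (allColourings n (suc j)))
count-properOnᵇ-leafOrdered {n} {j} {e ∷ E} ((s≢t , avs) ∷ leafOrdered) = begin
  (suc j ℕ.* suc j ℕ.^ m) ℕ.* count (properOnᵇ (e ∷ E)) L
    ≡⟨ *-CS.xy∙z≈y∙xz (suc j) (suc j ℕ.^ m) _ ⟩
  suc j ℕ.^ m ℕ.* (suc j ℕ.* count (properOnᵇ (e ∷ E)) L)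
    ≡⟨ cong (suc j ℕ.^ m ℕ.*_) (count-properOnᵇ-leaf {j = j} {e = e} s≢t avs) ⟩
  suc j ℕ.^ m ℕ.* (j ℕ.* count (properOnᵇ E) L)
    ≡⟨ *-CS.x∙yz≈y∙xz (suc j ℕ.^ m) j _ ⟩
  j ℕ.* (suc j ℕ.^ m ℕ.* count (properOnᵇ E) L)
    ≡⟨ cong (j ℕ.*_) (count-properOnᵇ-leafOrdered {j = j} leafOrdered) ⟩
  j ℕ.* (j ℕ.^ m ℕ.* length L)
    ≡⟨ ℕ.*-assoc j (j ℕ.^ m) _ ⟨
  (j ℕ.* j ℕ.^ m) ℕ.* length L ∎
  where
  m : ℕ
  m = length E
  L : List (Colouring n (suc j))
  L = allColourings n (suc j)

-- A spanning tree of the Schreier graph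

root : (n : ℕ) → Word n
root n = replicate n false

-- On 0w the generators b, c act as a (and d trivially), on 1w the generators b, c, d act as
-- c, d, b.  So the {b,c,d}-edges of Γ_(n+1) are the a-edges of Γ_n in the half 0X^n and the
-- {b,c,d}-edges of Γ_n in the half 1X^n, while the a-edges join 0w and 1w.  An edge u—v of the
-- tree for Γ_n yields its copy in the half matching its kind and the a-edge at its target v;
-- with the a-edge at the root this reaches every a-edge, as every other word is a target.
half : Kind → Bool
half a-kind   = false
half bcd-kind = true

doubleEdges : List (Edge n) → List (Edge (suc n))
doubleEdges []               = []
doubleEdges (edge κ u v ∷ E) =
  edge a-kind (half κ ∷ v) (not (half κ) ∷ v) ∷ edge bcd-kind (half κ ∷ u) (half κ ∷ v) ∷ doubleEdges E

rootEdge : (n : ℕ) → Edge (suc n)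
rootEdge n = edge a-kind (false ∷ root n) (true ∷ root n)

treeEdges : (n : ℕ) → List (Edge n)
treeEdges zero    = []
treeEdges (suc n) = doubleEdges (treeEdges n) ++ rootEdge n ∷ []

length-doubleEdges : (E : List (Edge n)) → length (doubleEdges E) ≡ length E + length E
length-doubleEdges []      = refl
length-doubleEdges (_ ∷ E) = cong suc (trans (cong suc (length-doubleEdges E)) (sym (ℕ.+-suc _ _)))

length-treeEdges-suc : (n : ℕ) → length (treeEdges (suc n)) ≡ suc (length (treeEdges n) + length (treeEdges n))
length-treeEdges-suc n = begin
  length (doubleEdges (treeEdges n) ++ rootEdge n ∷ []) ≡⟨ Listₚ.length-++ (doubleEdges (treeEdges n)) ⟩
  length (doubleEdges (treeEdges n)) + 1                ≡⟨ ℕ.+-comm _ 1 ⟩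
  suc (length (doubleEdges (treeEdges n)))              ≡⟨ cong suc (length-doubleEdges (treeEdges n)) ⟩
  suc (length (treeEdges n) + length (treeEdges n))     ∎

length-treeEdges : (n : ℕ) → length (treeEdges n) + 1 ≡ 2 ℕ.^ n
length-treeEdges zero    = refl
length-treeEdges (suc n) = begin
  length (treeEdges (suc n)) + 1 ≡⟨ cong (ℕ._+ 1) (length-treeEdges-suc n) ⟩
  suc (m + m) + 1                ≡⟨ double-suc m ⟩
  (m + 1) + ((m + 1) + 0)        ≡⟨ cong (λ x → x + (x + 0)) (length-treeEdges n) ⟩
  2 ℕ.^ suc n                    ∎
  where
  m : ℕ
  m = length (treeEdges n)
  double-suc : ∀ x → suc (x + x) + 1 ≡ (x + 1) + ((x + 1) + 0)
  double-suc = solve-∀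

∷-≢ˡ : {b b′ : Bool} {w w′ : Word n} → b ≢ b′ → b ∷ w ≢ b′ ∷ w′
∷-≢ˡ b≢b′ = b≢b′ ∘ ∷-injectiveˡ

∷-≢ʳ : {b b′ : Bool} {w w′ : Word n} → w ≢ w′ → b ∷ w ≢ b′ ∷ w′
∷-≢ʳ w≢w′ = w≢w′ ∘ ∷-injectiveʳ

avoids-doubleEdges : {v : Word n} (b : Bool) {E : List (Edge n)} →
                     All (Avoids v) E → All (Avoids (b ∷ v)) (doubleEdges E)
avoids-doubleEdges b []                   = []
avoids-doubleEdges b ((u≢v , w≢v) ∷ avs) =
  (∷-≢ʳ w≢v , ∷-≢ʳ w≢v) ∷ (∷-≢ʳ u≢v , ∷-≢ʳ w≢v) ∷ avoids-doubleEdges b avs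

RootFree : List (Edge n) → Set
RootFree {n} = All (λ e → tgt e ≢ root n)

rootFree-treeEdges : (n : ℕ) → RootFree (treeEdges n)
rootFree-treeEdges zero    = []
rootFree-treeEdges (suc n) = All.++⁺ (doubled (rootFree-treeEdges n)) ((λ ()) ∷ [])
  where
  doubled : {E : List (Edge n)} → RootFree E → RootFree (doubleEdges E)
  doubled []          = []
  doubled (v≢r ∷ rfs) = ∷-≢ʳ v≢r ∷ ∷-≢ʳ v≢r ∷ doubled rfs

leafOrdered-treeEdges : (n : ℕ) → LeafOrdered (treeEdges n)
leafOrdered-treeEdges zero    = []
leafOrdered-treeEdges (suc n) = doubled (leafOrdered-treeEdges n) (rootFree-treeEdges n)
  where
  avoidsRest : {v : Word n} (b : Bool) {E : List (Edge n)} → v ≢ root n → All (Avoids v) E →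
               All (Avoids (b ∷ v)) (doubleEdges E ++ rootEdge n ∷ [])
  avoidsRest b v≢r avs =
    All.++⁺ (avoids-doubleEdges b avs) ((∷-≢ʳ (v≢r ∘ sym) , ∷-≢ʳ (v≢r ∘ sym)) ∷ [])
  doubled : {E : List (Edge n)} → LeafOrdered E → RootFree E → LeafOrdered (doubleEdges E ++ rootEdge n ∷ [])
  doubled [] [] = ((λ ()) , []) ∷ []
  doubled {edge κ u v ∷ E} ((u≢v , avs) ∷ leafOrdered) (v≢r ∷ rfs) =
    (∷-≢ˡ (not-¬ refl) , (∷-≢ˡ (not-¬ refl) , ∷-≢ˡ (not-¬ refl)) ∷ avoidsRest (not (half κ)) v≢r avs) ∷
    (∷-≢ʳ u≢v , avoidsRest (half κ) v≢r avs) ∷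
    doubled leafOrdered rfs

-- Properness on the tree

ProperOnKind : Kind → List (Edge n) → Colouring n k → Set
ProperOnKind κ E c = All (λ e → kind e ≡ κ → c (src e) ≢ c (tgt e)) E

generators : Kind → List Gen
generators a-kind   = ga ∷ []
generators bcd-kind = gb ∷ gc ∷ gd ∷ []

ProperFor : List Gen → Colouring n k → Set
ProperFor {n} gs c = (w : Word n) → All (ProperAt c w) gs

ProperAcross : Colouring (suc n) k → Set
ProperAcross {n} c = (w : Word n) → c (false ∷ w) ≢ c (true ∷ w)

act-[] : (s : Gen) → act s [] ≡ []
act-[] ga = refl
act-[] gb = refl
act-[] gc = refl
act-[] gd = refl

properFor-zero : (gs : List Gen) (c : Colouring zero k) → ProperFor gs c
properFor-zero gs c [] = All.universal (λ s loopFree → ⊥-elim (loopFree (act-[] s))) gs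

properFor-a-suc : (c : Colouring (suc n) k) → ProperFor (generators a-kind) c ⇔ ProperAcross c
properFor-a-suc c = mk⇔
  (λ pf w → All.head (pf (false ∷ w)) (λ ()))
  (λ { across (false ∷ w) → (λ _ → across w) ∷ []
      ; across (true  ∷ w) → (λ _ → across w ∘ sym) ∷ [] })

properFor-bcd-suc : (c : Colouring (suc n) k) → ProperFor (generators bcd-kind) c ⇔
  (ProperFor (generators a-kind) (c ∘ (false ∷_)) × ProperFor (generators bcd-kind) (c ∘ (true ∷_)))
properFor-bcd-suc {n} c = mk⇔ to from
  where
  lift : {b : Bool} {w : Word n} (s : Gen) → ProperAt (c ∘ (b ∷_)) w s →
         ¬ (b ∷ act s w ≡ b ∷ w) → c (b ∷ w) ≢ c (b ∷ act s w)
  lift {b} s proper loopFree = proper (loopFree ∘ cong (b ∷_))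
  lower : {b : Bool} {w : Word n} (s : Gen) → (¬ (b ∷ act s w ≡ b ∷ w) → c (b ∷ w) ≢ c (b ∷ act s w)) →
          ProperAt (c ∘ (b ∷_)) w s
  lower s proper loopFree = proper (loopFree ∘ ∷-injectiveʳ)
  to : ProperFor (generators bcd-kind) c →
       ProperFor (generators a-kind) (c ∘ (false ∷_)) × ProperFor (generators bcd-kind) (c ∘ (true ∷_))
  to pf = (λ w → lower ga (All.head (pf (false ∷ w))) ∷ []) , (λ w → rotate (pf (true ∷ w)))
    where
    rotate : {w : Word n} → All (ProperAt c (true ∷ w)) (generators bcd-kind) →
             All (ProperAt (c ∘ (true ∷_)) w) (generators bcd-kind)
    rotate (pb ∷ pc ∷ pd ∷ []) = lower gb pd ∷ lower gc pb ∷ lower gd pc ∷ []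
  from : ProperFor (generators a-kind) (c ∘ (false ∷_)) × ProperFor (generators bcd-kind) (c ∘ (true ∷_)) →
         ProperFor (generators bcd-kind) c
  from (pa , _) (false ∷ w) with pa w
  ... | pa′ ∷ [] = lift ga pa′ ∷ lift ga pa′ ∷ (λ loop → ⊥-elim (loop refl)) ∷ []
  from (_ , pbcd) (true ∷ w) with pbcd w
  ... | pb ∷ pc ∷ pd ∷ [] = lift gc pc ∷ lift gd pd ∷ lift gb pb ∷ []

module _ (c : Colouring (suc n) k) where

  properOnKind-a-doubleEdges⁺ : ProperAcross c → (E : List (Edge n)) → ProperOnKind a-kind (doubleEdges E) c
  properOnKind-a-doubleEdges⁺ across []                      = []
  properOnKind-a-doubleEdges⁺ across (edge a-kind   u v ∷ E) =
    (λ _ → across v) ∷ (λ ()) ∷ properOnKind-a-doubleEdges⁺ across E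
  properOnKind-a-doubleEdges⁺ across (edge bcd-kind u v ∷ E) =
    (λ _ → across v ∘ sym) ∷ (λ ()) ∷ properOnKind-a-doubleEdges⁺ across E

  properOnKind-a-doubleEdges⁻ : {w : Word n} (E : List (Edge n)) → ProperOnKind a-kind (doubleEdges E) c →
                                Any (λ e → tgt e ≡ w) E → c (false ∷ w) ≢ c (true ∷ w)
  properOnKind-a-doubleEdges⁻ (edge a-kind   u v ∷ E) (p ∷ _)      (here refl) = p refl
  properOnKind-a-doubleEdges⁻ (edge bcd-kind u v ∷ E) (p ∷ _)      (here refl) = p refl ∘ sym
  properOnKind-a-doubleEdges⁻ (edge _        u v ∷ E) (_ ∷ _ ∷ ps) (there i)   =
    properOnKind-a-doubleEdges⁻ E ps i

  properOnKind-bcd-doubleEdges : (E : List (Edge n)) → ProperOnKind bcd-kind (doubleEdges E) c ⇔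
    (ProperOnKind a-kind E (c ∘ (false ∷_)) × ProperOnKind bcd-kind E (c ∘ (true ∷_)))
  properOnKind-bcd-doubleEdges E = mk⇔ (to E) (from E)
    where
    to : (E : List (Edge n)) → ProperOnKind bcd-kind (doubleEdges E) c →
         ProperOnKind a-kind E (c ∘ (false ∷_)) × ProperOnKind bcd-kind E (c ∘ (true ∷_))
    to []                      []           = [] , []
    to (edge a-kind   u v ∷ E) (_ ∷ p ∷ ps) = let pa , pbcd = to E ps in
      (λ _ → p refl) ∷ pa , (λ ()) ∷ pbcd
    to (edge bcd-kind u v ∷ E) (_ ∷ p ∷ ps) = let pa , pbcd = to E ps in
      (λ ()) ∷ pa , (λ _ → p refl) ∷ pbcd
    from : (E : List (Edge n)) →
           ProperOnKind a-kind E (c ∘ (false ∷_)) × ProperOnKind bcd-kind E (c ∘ (true ∷_)) →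
           ProperOnKind bcd-kind (doubleEdges E) c
    from []                      ([] , [])              = []
    from (edge a-kind   u v ∷ E) (pa ∷ pas , _ ∷ pbcds) = (λ ()) ∷ (λ _ → pa refl) ∷ from E (pas , pbcds)
    from (edge bcd-kind u v ∷ E) (_ ∷ pas , pb ∷ pbcds) = (λ ()) ∷ (λ _ → pb refl) ∷ from E (pas , pbcds)

any-tgt-doubleEdges : {w : Word n} (b : Bool) (E : List (Edge n)) → Any (λ e → tgt e ≡ w) E →
                      Any (λ e → tgt e ≡ b ∷ w) (doubleEdges E)
any-tgt-doubleEdges true  (edge a-kind   u v ∷ E) (here refl) = here refl
any-tgt-doubleEdges false (edge a-kind   u v ∷ E) (here refl) = there (here refl)
any-tgt-doubleEdges true  (edge bcd-kind u v ∷ E) (here refl) = there (here refl)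
any-tgt-doubleEdges false (edge bcd-kind u v ∷ E) (here refl) = here refl
any-tgt-doubleEdges b     (_ ∷ E)                 (there i)   = there (there (any-tgt-doubleEdges b E i))

root-or-tgt-treeEdges : (n : ℕ) (w : Word n) → w ≡ root n ⊎ Any (λ e → tgt e ≡ w) (treeEdges n)
root-or-tgt-treeEdges zero    []      = inj₁ refl
root-or-tgt-treeEdges (suc n) (b ∷ w) with root-or-tgt-treeEdges n w | b
... | inj₁ refl | false = inj₁ refl
... | inj₁ refl | true  = inj₂ (Any.++⁺ʳ (doubleEdges (treeEdges n)) (here refl))
... | inj₂ i    | b     = inj₂ (Any.++⁺ˡ (any-tgt-doubleEdges b (treeEdges n) i))

properOnKind-treeEdges : (n : ℕ) (κ : Kind) (c : Colouring n k) →
                         ProperOnKind κ (treeEdges n) c ⇔ ProperFor (generators κ) c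
properOnKind-treeEdges zero    κ        c = mk⇔ (λ _ → properFor-zero (generators κ) c) (λ _ → [])
properOnKind-treeEdges (suc n) a-kind   c = ⇔-sym (properFor-a-suc c) ⇔-∘ mk⇔ to from
  where
  to : ProperOnKind a-kind (treeEdges (suc n)) c → ProperAcross c
  to proper w with root-or-tgt-treeEdges n w
  ... | inj₁ refl = All.head (All.++⁻ʳ (doubleEdges (treeEdges n)) proper) refl
  ... | inj₂ i    = properOnKind-a-doubleEdges⁻ c (treeEdges n) (All.++⁻ˡ (doubleEdges (treeEdges n)) proper) i
  from : ProperAcross c → ProperOnKind a-kind (treeEdges (suc n)) c
  from across = All.++⁺ (properOnKind-a-doubleEdges⁺ c across (treeEdges n)) ((λ _ → across (root n)) ∷ [])
properOnKind-treeEdges (suc n) bcd-kind c =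
  ⇔-sym (properFor-bcd-suc c) ⇔-∘
  ((properOnKind-treeEdges n a-kind _ ×-⇔ properOnKind-treeEdges n bcd-kind _) ⇔-∘
  (properOnKind-bcd-doubleEdges c (treeEdges n) ⇔-∘ dropRootEdge))
  where
  dropRootEdge : ProperOnKind bcd-kind (treeEdges (suc n)) c ⇔ ProperOnKind bcd-kind (doubleEdges (treeEdges n)) c
  dropRootEdge = mk⇔ (All.++⁻ˡ (doubleEdges (treeEdges n))) (λ proper → All.++⁺ proper ((λ ()) ∷ []))

∈-allWords : (w : Word n) → w ∈ allWords n
∈-allWords             []          = here refl
∈-allWords             (false ∷ w) = ∈-++⁺ˡ (∈-map⁺ (false ∷_) (∈-allWords w))
∈-allWords {n = suc n} (true  ∷ w) = ∈-++⁺ʳ (map (false ∷_) (allWords n)) (∈-map⁺ (true ∷_) (∈-allWords w))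

proper⇔properFor-kinds : (c : Colouring n k) →
                         Proper c ⇔ (ProperFor (generators a-kind) c × ProperFor (generators bcd-kind) c)
proper⇔properFor-kinds c = mk⇔
  (λ proper → (λ w → All.head (at proper w) ∷ []) , (λ w → All.tail (at proper w)))
  (λ (pa , pbcd) → All.tabulate λ {w} _ → All.head (pa w) ∷ pbcd w)
  where
  at : Proper c → ∀ w → All (ProperAt c w) gens
  at proper w = All.lookup proper (∈-allWords w)

properOn⇔properOnKinds : (E : List (Edge n)) (c : Colouring n k) →
                         ProperOn E c ⇔ (ProperOnKind a-kind E c × ProperOnKind bcd-kind E c)
properOn⇔properOnKinds E c = mk⇔
  (λ proper → All.map (λ p _ → p) proper , All.map (λ p _ → p) proper)
  (All.zipWith λ {e} (pa , pbcd) → byKind (kind e) pa pbcd)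
  where
  byKind : (κ : Kind) {P : Set} → (κ ≡ a-kind → P) → (κ ≡ bcd-kind → P) → P
  byKind a-kind   pa _    = pa refl
  byKind bcd-kind _  pbcd = pbcd refl

proper⇔properOn-treeEdges : (c : Colouring n k) → Proper c ⇔ ProperOn (treeEdges n) c
proper⇔properOn-treeEdges {n} c =
  ⇔-sym (properOn⇔properOnKinds (treeEdges n) c) ⇔-∘
  (⇔-sym (properOnKind-treeEdges n a-kind c ×-⇔ properOnKind-treeEdges n bcd-kind c) ⇔-∘
  proper⇔properFor-kinds c)

-- The chromatic polynomial

chromaticCount≡count-properOnᵇ : (n k : ℕ) →
  chromaticCount n k ≡ count (properOnᵇ (treeEdges n)) (allColourings n k)
chromaticCount≡count-properOnᵇ n k = trans (length-filter≡count proper? L) (∑-cong same-test L)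
  where
  same-test : (c : Colouring n k) → indicator (does (proper? c)) ≡ indicator (properOnᵇ (treeEdges n) c)
  same-test c = cong indicator (does-⇔ (proper⇔properOn-treeEdges c) (proper? c) (properOn? (treeEdges n) c))
  L : List (Colouring n k)
  L = allColourings n k

chromaticCount-suc : (n j : ℕ) → chromaticCount n (suc j) ≡ suc j ℕ.* j ℕ.^ length (treeEdges n)
chromaticCount-suc n j = ℕ.*-cancelˡ-≡ _ _ (suc j ℕ.^ M) {{ℕ.m^n≢0 (suc j) M}} (begin
  suc j ℕ.^ M ℕ.* chromaticCount n (suc j)
    ≡⟨ cong (suc j ℕ.^ M ℕ.*_) (chromaticCount≡count-properOnᵇ n (suc j)) ⟩
  suc j ℕ.^ M ℕ.* count (properOnᵇ (treeEdges n)) (allColourings n (suc j))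
    ≡⟨ count-properOnᵇ-leafOrdered (leafOrdered-treeEdges n) ⟩
  j ℕ.^ M ℕ.* length (allColourings n (suc j))
    ≡⟨ cong (j ℕ.^ M ℕ.*_) (length-allColourings n (suc j)) ⟩
  j ℕ.^ M ℕ.* suc j ℕ.^ 2 ℕ.^ n
    ≡⟨ cong (λ e → j ℕ.^ M ℕ.* suc j ℕ.^ e) (length-treeEdges n) ⟨
  j ℕ.^ M ℕ.* suc j ℕ.^ (M + 1)
    ≡⟨ cong (j ℕ.^ M ℕ.*_) (ℕ.^-distribˡ-+-* (suc j) M 1) ⟩
  j ℕ.^ M ℕ.* (suc j ℕ.^ M ℕ.* (suc j ℕ.* 1))
    ≡⟨ rearrange (j ℕ.^ M) (suc j ℕ.^ M) (suc j) ⟩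
  suc j ℕ.^ M ℕ.* (suc j ℕ.* j ℕ.^ M) ∎)
  where
  M : ℕ
  M = length (treeEdges n)
  rearrange : ∀ a b c → a ℕ.* (b ℕ.* (c ℕ.* 1)) ≡ b ℕ.* (c ℕ.* a)
  rearrange = solve-∀

neg-*-neg : (i j : ℤ) → - i * - j ≡ i * j
neg-*-neg = ℤ-Solver.solve-∀

neg-^-even : (i : ℤ) (m : ℕ) → (- i) ^ (m + m) ≡ i ^ (m + m)
neg-^-even i zero    = refl
neg-^-even i (suc m) rewrite ℕ.+-suc m m = begin
  - i * (- i * (- i) ^ (m + m)) ≡⟨ cong (λ x → - i * (- i * x)) (neg-^-even i m) ⟩
  - i * (- i * i ^ (m + m))     ≡⟨ square-neg i (i ^ (m + m)) ⟩
  i * (i * i ^ (m + m))         ∎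
  where
  square-neg : ∀ i x → - i * (- i * x) ≡ i * (i * x)
  square-neg = ℤ-Solver.solve-∀

neg-^-odd : (i : ℤ) (m : ℕ) → (- i) ^ suc (m + m) ≡ - (i ^ suc (m + m))
neg-^-odd i m = trans (cong (- i *_) (neg-^-even i m)) (sym (ℤ.neg-distribˡ-* i (i ^ (m + m))))

pos-^ : (a m : ℕ) → + (a ℕ.^ m) ≡ (+ a) ^ m
pos-^ a zero    = refl
pos-^ a (suc m) = trans (ℤ.pos-* a (a ℕ.^ m)) (cong (+ a *_) (pos-^ a m))

1-[1+n]≡-n : (n : ℕ) → + 1 - + suc n ≡ - + n
1-[1+n]≡-n zero    = refl
1-[1+n]≡-n (suc n) = refl

mainTheorem7 : (n : ℕ) → 1 ≤ n → (k : ℕ) → 1 ≤ k →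
    + (chromaticCount n k) ≡ - (+ k) * ((+ 1 - + k) ^ (2 Data.Nat.^ n ∸ 1))
mainTheorem7 (suc n) _ (suc j) _ = begin
  + chromaticCount (suc n) (suc j)                    ≡⟨ cong +_ (chromaticCount-suc (suc n) j) ⟩
  + (suc j ℕ.* j ℕ.^ M)                               ≡⟨ ℤ.pos-* (suc j) (j ℕ.^ M) ⟩
  + suc j * + (j ℕ.^ M)                               ≡⟨ cong (+ suc j *_) (pos-^ j M) ⟩
  + suc j * (+ j) ^ M                                 ≡⟨ neg-*-neg (+ suc j) _ ⟨
  - + suc j * - ((+ j) ^ M)                           ≡⟨ cong (- + suc j *_) odd-power ⟨
  - + suc j * (- + j) ^ M                             ≡⟨ cong₂ (λ b e → - + suc j * b ^ e) (1-[1+n]≡-n j) exponent ⟨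
  - (+ suc j) * ((+ 1 - + suc j) ^ (2 ℕ.^ suc n ∸ 1)) ∎
  where
  M : ℕ
  M = length (treeEdges (suc n))
  exponent : 2 ℕ.^ suc n ∸ 1 ≡ M
  exponent = trans (cong (_∸ 1) (sym (length-treeEdges (suc n)))) (ℕ.m+n∸n≡m M 1)
  odd-power : (- + j) ^ M ≡ - ((+ j) ^ M)
  odd-power = subst (λ e → (- + j) ^ e ≡ - ((+ j) ^ e)) (sym (length-treeEdges-suc n))
                    (neg-^-odd (+ j) (length (treeEdges n)))
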